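{- For all integers $n,m\ge 0$, $$\sum_{j=0}^{n}(-1)^jq^{\binom{j}{2}}\begin{bmatrix} n\\ j\end{bmatrix}\prod_{i=n+m+1-j}^{n+m}(1+q^i)\;T_{2n+m-j}(1,s,q)=q^{n^2+mn}s^nT_m(1,s,q).$$
   Context: Let $q$ be a real number with $q\neq -1$. Let $[m]=1+q+\dots+q^{m-1}$, $[m]!=[1]\cdots[m]$, $\begin{bmatrix} m\\ j\end{bmatrix}=\frac{[m]!}{[j]![m-j]!}$. $T_0(x,s,q)=1$, $T_1(x,s,q)=x$, $T_n(x,s,q)=(1+q^{n-1})xT_{n-1}(x,s,q)+q^{n-1}sT_{n-2}(x,s,q)$ for $n\ge2$; $T_n(1,s,q)$ is its value at $x=1$. Empty products equal $1$. -}

module Defs where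

open import Level using (0ℓ)
open import Data.Nat using (ℕ; zero; suc; _∸_)
open import Data.Product using (Σ; ∃; _×_)
open import Relation.Nullary using (¬_)
open import Relation.Binary.Core using (Rel)
open import Relation.Binary.Structures using (IsTotalOrder)
open import Algebra.Bundles using (CommutativeRing)

-- The real numbers, axiomatised as a complete ordered field
-- (any two such structures are isomorphic, so quantifying over all of
-- them is the same as speaking about ℝ).
record RealField : Set₁ where
  field
    commRing : CommutativeRing 0ℓ 0ℓ
  open CommutativeRing commRing public
  field
    _⁻¹       : Carrier → Carrier
    ⁻¹-cong   : ∀ {x y} → x ≈ y → x ⁻¹ ≈ y ⁻¹
    0≉1       : ¬ (0# ≈ 1#)
    inverseʳ  : ∀ x → ¬ (x ≈ 0#) → (x * x ⁻¹) ≈ 1#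
    0⁻¹       : (0# ⁻¹) ≈ 0#
    _≤_       : Rel Carrier 0ℓ
    isTotalOrder : IsTotalOrder _≈_ _≤_
    +-monoˡ-≤ : ∀ {x y} z → x ≤ y → (x + z) ≤ (y + z)
    *-nonneg  : ∀ {x y} → 0# ≤ x → 0# ≤ y → 0# ≤ (x * y)
    complete  : (P : Carrier → Set) → ∃ P →
                (Σ Carrier λ b → ∀ x → P x → x ≤ b) →
                Σ Carrier λ u → (∀ x → P x → x ≤ u) ×
                                (∀ b → (∀ x → P x → x ≤ b) → u ≤ b)

module Ops (R : RealField) where
  open RealField R public

  infixr 8 _^_
  _^_ : Carrier → ℕ → Carrier
  x ^ zero  = 1#
  x ^ suc n = x * (x ^ n)

  sgn : ℕ → Carrier
  sgn j = (- 1#) ^ j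

  sumTo : ℕ → (ℕ → Carrier) → Carrier
  sumTo zero    f = f 0
  sumTo (suc n) f = sumTo n f + f (suc n)

  prodFrom : ℕ → ℕ → (ℕ → Carrier) → Carrier
  prodFrom a zero      f = 1#
  prodFrom a (suc len) f = f a * prodFrom (suc a) len f

  qint : Carrier → ℕ → Carrier
  qint q zero    = 0#
  qint q (suc m) = qint q m + q ^ m

  qfact : Carrier → ℕ → Carrier
  qfact q zero    = 1#
  qfact q (suc m) = qfact q m * qint q (suc m)

  -- q-binomial [m choose j] = [m]! / ([j]! [m-j]!)  (used only for j ≤ m)
  qbinom : Carrier → ℕ → ℕ → Carrier
  qbinom q m j = qfact q m * (qfact q j * qfact q (m ∸ j)) ⁻¹

  T : Carrier → Carrier → Carrier → ℕ → Carrier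
  T x s q zero          = 1#
  T x s q (suc zero)    = x
  T x s q (suc (suc n)) =
    ((1# + q ^ suc n) * x) * T x s q (suc n) + ((q ^ suc n) * s) * T x s q n

module Submission where

-- Write S(n,m) for the left-hand side and R(n,m) for the right-hand side.  Both satisfy
--   S(n+1,m) + q^n (1 + q^(m+1)) S(n,m+1) = S(n,m+2):
-- for R this is the three-term recurrence of T at x = 1; for S it holds term by term, since
-- the two q-Pascal rules for [n+1 choose j+1] turn the (j+1)-th term of S(n+1,m) plus the
-- weighted j-th term of S(n,m+1) into the (j+1)-th term of S(n,m+2).  Induction on n
-- reduces the claim to n = 0.  The q-binomial is handled through its Pascal recurrence; it
-- agrees with the factorial quotient because [k] ≠ 0 for real q ≠ -1: otherwise q^k = 1,
-- so q² = 1, so q = 1, and then [k] = k.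

open import Defs
import Algebra.Properties.CommutativeSemiring.Exp as SemiringExp
import Algebra.Properties.Ring as RingProperties
import Algebra.Solver.Ring.NaturalCoefficients.Default as NaturalSolver
open import Data.Nat using (ℕ; zero; suc; z≤n; s≤s)
  renaming (_+_ to _+ℕ_; _*_ to _*ℕ_; _∸_ to _∸ℕ_; _≤_ to _≤ℕ_; _<_ to _<ℕ_)
import Data.Nat.Properties as ℕ
open import Data.Nat.Combinatorics using (_C_; nC1≡n; nCk+nC[k+1]≡[n+1]C[k+1])
open import Data.Nat.Tactic.RingSolver using (solve-∀)
open import Data.Sum using (inj₁; inj₂)
open import Function using (_∘_)
open import Relation.Nullary using (¬_)
import Relation.Binary.PropositionalEquality as ≡
open import Relation.Binary.Structures using (IsTotalOrder)

[1+n]C2≡nC2+n : ∀ n → suc n C 2 ≡.≡ n C 2 +ℕ n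
[1+n]C2≡nC2+n n = ≡.trans (≡.sym (nCk+nC[k+1]≡[n+1]C[k+1] n 1))
  (≡.trans (≡.cong (_+ℕ n C 2) (nC1≡n n)) (ℕ.+-comm n (n C 2)))

module _ (R : RealField) where
  open Ops R hiding (zero) renaming (_≤_ to infix 4 _≤_)
  open RingProperties ring
    using (+-cancelʳ; -1*x≈-x; +-inverseˡ-unique; -‿distribˡ-*; -‿distribʳ-*; -‿involutive)
  open NaturalSolver commutativeSemiring using (solve; _:+_; _:*_; _:=_; con)
  open import Relation.Binary.Reasoning.Setoid setoid
  private
    module Exp = SemiringExp commutativeSemiring
    module ≤ = IsTotalOrder isTotalOrder

  ^-congʳ : ∀ x {m n} → m ≡.≡ n → x ^ m ≈ x ^ n
  ^-congʳ x ≡.refl = refl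

  ^≈Exp^ : ∀ x n → x ^ n ≈ x Exp.^ n
  ^≈Exp^ x zero    = refl
  ^≈Exp^ x (suc n) = *-congˡ (^≈Exp^ x n)

  ^-homo-* : ∀ x m n → x ^ (m +ℕ n) ≈ x ^ m * x ^ n
  ^-homo-* x m n = begin
    x ^ (m +ℕ n)            ≈⟨ ^≈Exp^ x (m +ℕ n) ⟩
    x Exp.^ (m +ℕ n)        ≈⟨ Exp.^-homo-* x m n ⟩
    x Exp.^ m * x Exp.^ n   ≈⟨ *-cong (^≈Exp^ x m) (^≈Exp^ x n) ⟨
    x ^ m * x ^ n           ∎

  ^-distrib-* : ∀ x y n → (x * y) ^ n ≈ x ^ n * y ^ n
  ^-distrib-* x y n = begin
    (x * y) ^ n             ≈⟨ ^≈Exp^ (x * y) n ⟩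
    (x * y) Exp.^ n         ≈⟨ Exp.^-distrib-* x y n ⟩
    x Exp.^ n * y Exp.^ n   ≈⟨ *-cong (^≈Exp^ x n) (^≈Exp^ y n) ⟨
    x ^ n * y ^ n           ∎

  1≉0 : ¬ 1# ≈ 0#
  1≉0 = 0≉1 ∘ sym

  *-cancelʳ-nonzero : ∀ {x y z} → ¬ z ≈ 0# → x * z ≈ y * z → x ≈ y
  *-cancelʳ-nonzero {x} {y} {z} z≉0 xz≈yz = begin
    x               ≈⟨ *-identityʳ x ⟨
    x * 1#          ≈⟨ *-congˡ (inverseʳ z z≉0) ⟨
    x * (z * z ⁻¹)  ≈⟨ *-assoc x z (z ⁻¹) ⟨
    x * z * z ⁻¹    ≈⟨ *-congʳ xz≈yz ⟩
    y * z * z ⁻¹    ≈⟨ *-assoc y z (z ⁻¹) ⟩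
    y * (z * z ⁻¹)  ≈⟨ *-congˡ (inverseʳ z z≉0) ⟩
    y * 1#          ≈⟨ *-identityʳ y ⟩
    y               ∎

  *-nonzero : ∀ {x y} → ¬ x ≈ 0# → ¬ y ≈ 0# → ¬ x * y ≈ 0#
  *-nonzero x≉0 y≉0 xy≈0 = x≉0 (*-cancelʳ-nonzero y≉0 (trans xy≈0 (sym (zeroˡ _))))

  pascal-combination : ∀ {G A B x y z} → G ≈ B + y * A → G ≈ A + x * B →
                       G * (1# + y * z) ≈ y * (1# + z) * A + B * (1# + x * y * z)
  pascal-combination {G} {A} {B} {x} {y} {z} G≈B+yA G≈A+xB = begin
    G * (1# + y * z)
      ≈⟨ solve 3 (λ G y z → G :* (con 1 :+ y :* z) := G :+ G :* (y :* z)) refl G y z ⟩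
    G + G * (y * z)
      ≈⟨ +-cong G≈B+yA (*-congʳ G≈A+xB) ⟩
    B + y * A + (A + x * B) * (y * z)
      ≈⟨ solve 5 (λ A B x y z → B :+ y :* A :+ (A :+ x :* B) :* (y :* z)
                                := y :* (con 1 :+ z) :* A :+ B :* (con 1 :+ x :* y :* z)) refl A B x y z ⟩
    y * (1# + z) * A + B * (1# + x * y * z) ∎

  alternating-cancel : ∀ {σ σ′ X Y Z K} → σ′ + σ ≈ 0# → X ≈ Y + Z →
                       σ′ * X * K + σ * Y * K ≈ σ′ * Z * K
  alternating-cancel {σ} {σ′} {X} {Y} {Z} {K} σ′+σ≈0 X≈Y+Z = begin
    σ′ * X * K + σ * Y * K
      ≈⟨ +-congʳ (*-congʳ (*-congˡ X≈Y+Z)) ⟩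
    σ′ * (Y + Z) * K + σ * Y * K
      ≈⟨ solve 5 (λ σ σ′ Y Z K → σ′ :* (Y :+ Z) :* K :+ σ :* Y :* K
                                 := (σ′ :+ σ) :* (Y :* K) :+ σ′ :* Z :* K) refl σ σ′ Y Z K ⟩
    (σ′ + σ) * (Y * K) + σ′ * Z * K
      ≈⟨ +-congʳ (trans (*-congʳ σ′+σ≈0) (zeroˡ (Y * K))) ⟩
    0# + σ′ * Z * K
      ≈⟨ +-identityˡ _ ⟩
    σ′ * Z * K ∎

  sgn-suc+sgn : ∀ j → sgn (suc j) + sgn j ≈ 0#
  sgn-suc+sgn j = trans (+-congʳ (-1*x≈-x (sgn j))) (-‿inverseˡ (sgn j))

  x*x-nonneg : ∀ x → 0# ≤ x * x
  x*x-nonneg x with ≤.total 0# x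
  ... | inj₁ 0≤x = *-nonneg 0≤x 0≤x
  ... | inj₂ x≤0 = ≤.≲-respʳ-≈ -x*-x≈x*x (*-nonneg 0≤-x 0≤-x)
    where
    0≤-x : 0# ≤ - x
    0≤-x = ≤.≲-respˡ-≈ (-‿inverseʳ x) (≤.≲-respʳ-≈ (+-identityˡ (- x)) (+-monoˡ-≤ (- x) x≤0))
    -x*-x≈x*x : - x * - x ≈ x * x
    -x*-x≈x*x = begin
      - x * - x      ≈⟨ -‿distribˡ-* x (- x) ⟨
      - (x * - x)    ≈⟨ -‿cong (-‿distribʳ-* x x) ⟨
      - - (x * x)    ≈⟨ -‿involutive (x * x) ⟩
      x * x          ∎

  0≤1 : 0# ≤ 1#
  0≤1 = ≤.≲-respʳ-≈ (*-identityʳ 1#) (x*x-nonneg 1#)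

  x≤x+y : ∀ {x y} → 0# ≤ y → x ≤ x + y
  x≤x+y {x} {y} 0≤y = ≤.≲-respˡ-≈ (+-identityˡ x) (≤.≲-respʳ-≈ (+-comm y x) (+-monoˡ-≤ x 0≤y))

  ^-nonneg : ∀ {x} → 0# ≤ x → ∀ n → 0# ≤ x ^ n
  ^-nonneg 0≤x zero    = 0≤1
  ^-nonneg 0≤x (suc n) = *-nonneg 0≤x (^-nonneg 0≤x n)

  sumTo-cong : ∀ n {f g : ℕ → Carrier} → (∀ j → j ≤ℕ n → f j ≈ g j) → sumTo n f ≈ sumTo n g
  sumTo-cong zero    f≈g = f≈g 0 z≤n
  sumTo-cong (suc n) f≈g =
    +-cong (sumTo-cong n (λ j j≤n → f≈g j (ℕ.m≤n⇒m≤1+n j≤n))) (f≈g (suc n) ℕ.≤-refl)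

  sumTo-suc-combine : ∀ n c {f g h : ℕ → Carrier} → f 0 ≈ h 0 →
                      (∀ j → j ≤ℕ n → f (suc j) + c * g j ≈ h (suc j)) →
                      sumTo (suc n) f + c * sumTo n g ≈ sumTo (suc n) h
  sumTo-suc-combine zero c {f} {g} {h} f0≈h0 step = begin
    f 0 + f 1 + c * g 0    ≈⟨ +-assoc (f 0) (f 1) (c * g 0) ⟩
    f 0 + (f 1 + c * g 0)  ≈⟨ +-cong f0≈h0 (step 0 z≤n) ⟩
    h 0 + h 1              ∎
  sumTo-suc-combine (suc n) c {f} {g} {h} f0≈h0 step = begin
    sumTo (suc n) f + f (suc (suc n)) + c * (sumTo n g + g (suc n))
      ≈⟨ solve 5 (λ F f′ c G g′ → F :+ f′ :+ c :* (G :+ g′) := (F :+ c :* G) :+ (f′ :+ c :* g′))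
               refl (sumTo (suc n) f) (f (suc (suc n))) c (sumTo n g) (g (suc n)) ⟩
    (sumTo (suc n) f + c * sumTo n g) + (f (suc (suc n)) + c * g (suc n))
      ≈⟨ +-cong (sumTo-suc-combine n c f0≈h0 (λ j j≤n → step j (ℕ.m≤n⇒m≤1+n j≤n)))
                (step (suc n) ℕ.≤-refl) ⟩
    sumTo (suc n) h + h (suc (suc n)) ∎

  prodFrom-snoc : ∀ a l f → prodFrom a (suc l) f ≈ prodFrom a l f * f (a +ℕ l)
  prodFrom-snoc a zero    f =
    trans (*-comm (f a) 1#) (*-congˡ (reflexive (≡.cong f (≡.sym (ℕ.+-identityʳ a)))))
  prodFrom-snoc a (suc l) f = begin
    f a * prodFrom (suc a) (suc l) f                ≈⟨ *-congˡ (prodFrom-snoc (suc a) l f) ⟩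
    f a * (prodFrom (suc a) l f * f (suc a +ℕ l))    ≈⟨ *-assoc (f a) _ _ ⟨
    f a * prodFrom (suc a) l f * f (suc a +ℕ l)      ≈⟨ *-congˡ (reflexive (≡.cong f (≡.sym (ℕ.+-suc a l)))) ⟩
    f a * prodFrom (suc a) l f * f (a +ℕ suc l)      ∎

  qint-suc : ∀ q k → qint q (suc k) ≈ 1# + q * qint q k
  qint-suc q zero    = solve 1 (λ q → con 0 :+ con 1 := con 1 :+ q :* con 0) refl q
  qint-suc q (suc k) = begin
    qint q (suc k) + q ^ suc k          ≈⟨ +-congʳ (qint-suc q k) ⟩
    1# + q * qint q k + q * q ^ k
      ≈⟨ solve 3 (λ q I P → con 1 :+ q :* I :+ q :* P := con 1 :+ q :* (I :+ P)) refl q (qint q k) (q ^ k) ⟩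
    1# + q * (qint q k + q ^ k)         ∎

  qint-+ : ∀ q a b → qint q (a +ℕ b) ≈ qint q a + q ^ a * qint q b
  qint-+ q zero    b = solve 2 (λ q I → I := con 0 :+ con 1 :* I) refl q (qint q b)
  qint-+ q (suc a) b = begin
    qint q (suc (a +ℕ b))                          ≈⟨ qint-suc q (a +ℕ b) ⟩
    1# + q * qint q (a +ℕ b)                       ≈⟨ +-congˡ (*-congˡ (qint-+ q a b)) ⟩
    1# + q * (qint q a + q ^ a * qint q b)
      ≈⟨ solve 4 (λ q A P B → con 1 :+ q :* (A :+ P :* B) := (con 1 :+ q :* A) :+ (q :* P) :* B)
                 refl q (qint q a) (q ^ a) (qint q b) ⟩
    (1# + q * qint q a) + q ^ suc a * qint q b     ≈⟨ +-congʳ (qint-suc q a) ⟨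
    qint q (suc a) + q ^ suc a * qint q b          ∎

  qint-≥1 : ∀ {q} → 0# ≤ q → ∀ k → 1# ≤ qint q (suc k)
  qint-≥1 0≤q zero    = ≤.reflexive (sym (+-identityˡ 1#))
  qint-≥1 0≤q (suc k) = ≤.trans (qint-≥1 0≤q k) (x≤x+y (^-nonneg 0≤q (suc k)))

  qint-nonzero-nonneg : ∀ {q} → 0# ≤ q → ∀ k → ¬ qint q (suc k) ≈ 0#
  qint-nonzero-nonneg 0≤q k [k+1]≈0 = 1≉0 (≤.antisym (≤.≲-respʳ-≈ [k+1]≈0 (qint-≥1 0≤q k)) 0≤1)

  -- r^(k+1) = 1 turns [k+2] = [k+1] + r^(k+1) = 1 + r [k+1] into [k+1] = r [k+1], and [k+1] ≥ 1 cancels.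
  nonneg-root-of-unity : ∀ {r} k → 0# ≤ r → r ^ suc k ≈ 1# → r ≈ 1#
  nonneg-root-of-unity {r} k 0≤r r^[k+1]≈1 =
    sym (*-cancelʳ-nonzero (qint-nonzero-nonneg 0≤r k) (trans (*-identityˡ I) I≈r*I))
    where
    I : Carrier
    I = qint r (suc k)
    I≈r*I : I ≈ r * I
    I≈r*I = +-cancelʳ 1# I (r * I) (begin
      I + 1#           ≈⟨ +-congˡ r^[k+1]≈1 ⟨
      I + r ^ suc k    ≈⟨ qint-suc r (suc k) ⟩
      1# + r * I       ≈⟨ +-comm 1# (r * I) ⟩
      r * I + 1#       ∎)

  qint-nonzero : ∀ {q} → ¬ q ≈ - 1# → ∀ k → ¬ qint q (suc k) ≈ 0#
  qint-nonzero {q} q≉-1 k [k+1]≈0 = qint-nonzero-nonneg (≤.≲-respʳ-≈ (sym q≈1) 0≤1) k [k+1]≈0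
    where
    q^[k+1]≈1 : q ^ suc k ≈ 1#
    q^[k+1]≈1 = begin
      q ^ suc k                    ≈⟨ +-identityˡ _ ⟨
      0# + q ^ suc k               ≈⟨ +-congʳ [k+1]≈0 ⟨
      qint q (suc k) + q ^ suc k   ≈⟨ qint-suc q (suc k) ⟩
      1# + q * qint q (suc k)      ≈⟨ +-congˡ (trans (*-congˡ [k+1]≈0) (zeroʳ q)) ⟩
      1# + 0#                      ≈⟨ +-identityʳ 1# ⟩
      1#                           ∎
    q*q≈1 : q * q ≈ 1#
    q*q≈1 = nonneg-root-of-unity k (x*x-nonneg q)
      (trans (^-distrib-* q q (suc k)) (trans (*-cong q^[k+1]≈1 q^[k+1]≈1) (*-identityʳ 1#)))
    q+1≉0 : ¬ q + 1# ≈ 0#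
    q+1≉0 = q≉-1 ∘ +-inverseˡ-unique q 1#
    q≈1 : q ≈ 1#
    q≈1 = *-cancelʳ-nonzero q+1≉0 (begin
      q * (q + 1#)     ≈⟨ distribˡ q q 1# ⟩
      q * q + q * 1#   ≈⟨ +-cong q*q≈1 (*-identityʳ q) ⟩
      1# + q           ≈⟨ +-comm 1# q ⟩
      q + 1#           ≈⟨ *-identityˡ (q + 1#) ⟨
      1# * (q + 1#)    ∎)

  qfact-nonzero : ∀ {q} → ¬ q ≈ - 1# → ∀ k → ¬ qfact q k ≈ 0#
  qfact-nonzero q≉-1 zero    = 1≉0
  qfact-nonzero q≉-1 (suc k) = *-nonzero (qfact-nonzero q≉-1 k) (qint-nonzero q≉-1 k)

  module _ (q : Carrier) where

    -- The q-binomial coefficient by the q-Pascal rule, free of the division in qbinom.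
    gauss : ℕ → ℕ → Carrier
    gauss n       zero    = 1#
    gauss zero    (suc j) = 0#
    gauss (suc n) (suc j) = gauss n j + q ^ suc j * gauss n (suc j)

    gauss-vanishes : ∀ {n j} → n <ℕ j → gauss n j ≈ 0#
    gauss-vanishes {zero}  {suc j} _         = refl
    gauss-vanishes {suc n} {suc j} (s≤s n<j) = begin
      gauss n j + q ^ suc j * gauss n (suc j)
        ≈⟨ +-cong (gauss-vanishes n<j) (*-congˡ (gauss-vanishes (ℕ.m<n⇒m<1+n n<j))) ⟩
      0# + q ^ suc j * 0#
        ≈⟨ trans (+-identityˡ _) (zeroʳ _) ⟩
      0# ∎

    gauss-pascalʳ : ∀ n j → j ≤ℕ n → gauss (suc n) (suc j) ≈ gauss n (suc j) + q ^ (n ∸ℕ j) * gauss n j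
    gauss-pascalʳ zero    zero    _ =
      solve 1 (λ q → con 1 :+ (q :* con 1) :* con 0 := con 0 :+ con 1 :* con 1) refl q
    gauss-pascalʳ (suc n) zero    _ = begin
      1# + q ^ 1 * gauss (suc n) 1
        ≈⟨ +-congˡ (*-congˡ (gauss-pascalʳ n 0 z≤n)) ⟩
      1# + q ^ 1 * (gauss n 1 + q ^ n * 1#)
        ≈⟨ solve 3 (λ q G P → con 1 :+ (q :* con 1) :* (G :+ P :* con 1)
                              := (con 1 :+ (q :* con 1) :* G) :+ (q :* P) :* con 1) refl q (gauss n 1) (q ^ n) ⟩
      gauss (suc n) 1 + q ^ suc n * 1# ∎
    gauss-pascalʳ (suc n) (suc j) (s≤s j≤n) with ℕ.m≤n⇒m<n∨m≡n j≤n
    ... | inj₂ ≡.refl = begin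
      G + q ^ suc (suc j) * gauss (suc j) (suc (suc j))
        ≈⟨ +-congˡ (*-congˡ (gauss-vanishes {suc j} ℕ.≤-refl)) ⟩
      G + q ^ suc (suc j) * 0#
        ≈⟨ solve 2 (λ G x → G :+ x :* con 0 := con 0 :+ con 1 :* G) refl G (q ^ suc (suc j)) ⟩
      0# + 1# * G
        ≈⟨ +-cong (sym (gauss-vanishes {suc j} ℕ.≤-refl)) (*-congʳ (^-congʳ q (≡.sym (ℕ.n∸n≡0 j)))) ⟩
      gauss (suc j) (suc (suc j)) + q ^ (j ∸ℕ j) * G ∎
      where
      G : Carrier
      G = gauss (suc j) (suc j)
    ... | inj₁ j<n = begin
      G₁ + (q * x) * G₂
        ≈⟨ +-cong (trans (gauss-pascalʳ n j j≤n) (+-congˡ (*-congʳ q^[n∸j]≈q*e)))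
                  (*-congˡ (gauss-pascalʳ n (suc j) j<n)) ⟩
      (B + (q * e) * A) + (q * x) * (C + e * B)
        ≈⟨ solve 6 (λ q x e A B C → (B :+ (q :* e) :* A) :+ (q :* x) :* (C :+ e :* B)
                                    := (B :+ (q :* x) :* C) :+ (q :* e) :* (A :+ x :* B)) refl q x e A B C ⟩
      G₂ + (q * e) * G₁
        ≈⟨ +-congˡ (*-congʳ q^[n∸j]≈q*e) ⟨
      G₂ + q ^ (n ∸ℕ j) * G₁ ∎
      where
      A B C G₁ G₂ x e : Carrier
      A = gauss n j
      B = gauss n (suc j)
      C = gauss n (suc (suc j))
      G₁ = gauss (suc n) (suc j)
      G₂ = gauss (suc n) (suc (suc j))
      x = q ^ suc j
      e = q ^ (n ∸ℕ suc j)
      q^[n∸j]≈q*e : q ^ (n ∸ℕ j) ≈ q * e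
      q^[n∸j]≈q*e = ^-congʳ q (ℕ.+-∸-assoc 1 j<n)

    qfact-split : ∀ n j → j ≤ℕ n → qfact q n ≈ gauss n j * (qfact q j * qfact q (n ∸ℕ j))
    qfact-split n       zero    _ = sym (trans (*-identityˡ _) (*-identityˡ _))
    qfact-split (suc n) (suc j) (s≤s j≤n) with ℕ.m≤n⇒m<n∨m≡n j≤n
    ... | inj₂ ≡.refl = begin
      F * I
        ≈⟨ *-congʳ (qfact-split j j ℕ.≤-refl) ⟩
      A * (F * F₀) * I
        ≈⟨ solve 5 (λ A x F I F₀ → A :* (F :* F₀) :* I := (A :+ x :* con 0) :* ((F :* I) :* F₀))
                   refl A x F I F₀ ⟩
      (A + x * 0#) * (F * I * F₀)
        ≈⟨ *-congʳ (+-congˡ (*-congˡ (gauss-vanishes {j} ℕ.≤-refl))) ⟨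
      (A + x * gauss j (suc j)) * (F * I * F₀) ∎
      where
      A x F I F₀ : Carrier
      A = gauss j j
      x = q ^ suc j
      F = qfact q j
      I = qint q (suc j)
      F₀ = qfact q (j ∸ℕ j)
    ... | inj₁ j<n = begin
      Fₙ * qint q (suc n)
        ≈⟨ *-congˡ [n+1]≈[j+1]+x[n-j] ⟩
      Fₙ * (Iⱼ + x * I′)
        ≈⟨ distribˡ Fₙ Iⱼ (x * I′) ⟩
      Fₙ * Iⱼ + Fₙ * (x * I′)
        ≈⟨ +-cong (*-congʳ (trans (qfact-split n j j≤n) (*-congˡ (*-congˡ Fₙ₋ⱼ≈F′*I′))))
                  (*-congʳ (qfact-split n (suc j) j<n)) ⟩
      A * (Fⱼ * (F′ * I′)) * Iⱼ + B * (Fⱼ * Iⱼ * F′) * (x * I′)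
        ≈⟨ solve 7 (λ A B x Fⱼ Iⱼ F′ I′ → A :* (Fⱼ :* (F′ :* I′)) :* Iⱼ
                                            :+ B :* (Fⱼ :* Iⱼ :* F′) :* (x :* I′)
                                          := (A :+ x :* B) :* (Fⱼ :* Iⱼ :* (F′ :* I′)))
                   refl A B x Fⱼ Iⱼ F′ I′ ⟩
      (A + x * B) * (Fⱼ * Iⱼ * (F′ * I′))
        ≈⟨ *-congˡ (*-congˡ Fₙ₋ⱼ≈F′*I′) ⟨
      (A + x * B) * (Fⱼ * Iⱼ * qfact q (n ∸ℕ j)) ∎
      where
      A B x Fₙ Fⱼ Iⱼ F′ I′ : Carrier
      A = gauss n j
      B = gauss n (suc j)
      x = q ^ suc j
      Fₙ = qfact q n
      Fⱼ = qfact q j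
      Iⱼ = qint q (suc j)
      F′ = qfact q (n ∸ℕ suc j)
      I′ = qint q (suc (n ∸ℕ suc j))
      Fₙ₋ⱼ≈F′*I′ : qfact q (n ∸ℕ j) ≈ F′ * I′
      Fₙ₋ⱼ≈F′*I′ = reflexive (≡.cong (qfact q) (ℕ.+-∸-assoc 1 j<n))
      [n+1]≈[j+1]+x[n-j] : qint q (suc n) ≈ Iⱼ + x * I′
      [n+1]≈[j+1]+x[n-j] = trans (reflexive (≡.cong (qint q ∘ suc) (≡.sym j+[1+n∸[1+j]]≡n)))
                                 (qint-+ q (suc j) (suc (n ∸ℕ suc j)))
        where
        j+[1+n∸[1+j]]≡n : j +ℕ suc (n ∸ℕ suc j) ≡.≡ n
        j+[1+n∸[1+j]]≡n = ≡.trans (ℕ.+-suc j (n ∸ℕ suc j)) (ℕ.m+[n∸m]≡n j<n)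

    qbinom≈gauss : ¬ q ≈ - 1# → ∀ {n j} → j ≤ℕ n → qbinom q n j ≈ gauss n j
    qbinom≈gauss q≉-1 {n} {j} j≤n = begin
      qfact q n * D ⁻¹          ≈⟨ *-congʳ (qfact-split n j j≤n) ⟩
      gauss n j * D * D ⁻¹      ≈⟨ *-assoc (gauss n j) D (D ⁻¹) ⟩
      gauss n j * (D * D ⁻¹)    ≈⟨ *-congˡ (inverseʳ D D≉0) ⟩
      gauss n j * 1#            ≈⟨ *-identityʳ (gauss n j) ⟩
      gauss n j                 ∎
      where
      D : Carrier
      D = qfact q j * qfact q (n ∸ℕ j)
      D≉0 : ¬ D ≈ 0#
      D≉0 = *-nonzero (qfact-nonzero q≉-1 j) (qfact-nonzero q≉-1 (n ∸ℕ j))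

  module _ (q s : Carrier) where

    t : ℕ → Carrier
    t = T 1# s q

    summand : ℕ → ℕ → ℕ → Carrier
    summand n m j = sgn j * q ^ (j C 2) * gauss q n j
                    * prodFrom (suc (n +ℕ m) ∸ℕ j) j (λ i → 1# + q ^ i)
                    * t ((2 *ℕ n +ℕ m) ∸ℕ j)

    rhs : ℕ → ℕ → Carrier
    rhs n m = q ^ (n *ℕ n +ℕ m *ℕ n) * s ^ n * t m

    weight : ℕ → ℕ → Carrier
    weight n m = q ^ n * (1# + q ^ suc m)

    rhs-recurrence : ∀ n m → rhs (suc n) m + weight n m * rhs n (suc m) ≈ rhs n (suc (suc m))
    rhs-recurrence n m = begin
      rhs (suc n) m + weight n m * rhs n (suc m)
        ≈⟨ +-cong (*-congʳ (*-congʳ q^[[1+n]²+m[1+n]])) (*-congˡ (*-congʳ (*-congʳ q^[n²+[1+m]n]))) ⟩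
      E * (qⁿ * (qⁿ * z)) * (s * S) * t m + qⁿ * (1# + z) * (E * qⁿ * S * t (suc m))
        ≈⟨ solve 7 (λ E qⁿ z s S t₀ t₁ → E :* (qⁿ :* (qⁿ :* z)) :* (s :* S) :* t₀
                                           :+ qⁿ :* (con 1 :+ z) :* (E :* qⁿ :* S :* t₁)
                                         := E :* (qⁿ :* qⁿ) :* S :* ((con 1 :+ z) :* con 1 :* t₁ :+ z :* s :* t₀))
                   refl E qⁿ z s S (t m) (t (suc m)) ⟩
      E * (qⁿ * qⁿ) * S * t (suc (suc m))
        ≈⟨ *-congʳ (*-congʳ q^[n²+[2+m]n]) ⟨
      rhs n (suc (suc m)) ∎
      where
      k : ℕ
      k = n *ℕ n +ℕ m *ℕ n
      E qⁿ z S : Carrier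
      E = q ^ k
      qⁿ = q ^ n
      z = q ^ suc m
      S = s ^ n
      q^[[1+n]²+m[1+n]] : q ^ (suc n *ℕ suc n +ℕ m *ℕ suc n) ≈ E * (qⁿ * (qⁿ * z))
      q^[[1+n]²+m[1+n]] = begin
        q ^ (suc n *ℕ suc n +ℕ m *ℕ suc n)   ≈⟨ ^-congʳ q (e n m) ⟩
        q ^ (k +ℕ (n +ℕ (n +ℕ suc m)))       ≈⟨ ^-homo-* q k (n +ℕ (n +ℕ suc m)) ⟩
        E * q ^ (n +ℕ (n +ℕ suc m))          ≈⟨ *-congˡ (^-homo-* q n (n +ℕ suc m)) ⟩
        E * (qⁿ * q ^ (n +ℕ suc m))          ≈⟨ *-congˡ (*-congˡ (^-homo-* q n (suc m))) ⟩
        E * (qⁿ * (qⁿ * z))                  ∎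
        where
        e : ∀ n m → suc n *ℕ suc n +ℕ m *ℕ suc n ≡.≡ (n *ℕ n +ℕ m *ℕ n) +ℕ (n +ℕ (n +ℕ suc m))
        e = solve-∀
      q^[n²+[1+m]n] : q ^ (n *ℕ n +ℕ suc m *ℕ n) ≈ E * qⁿ
      q^[n²+[1+m]n] = trans (^-congʳ q (e n m)) (^-homo-* q k n)
        where
        e : ∀ n m → n *ℕ n +ℕ suc m *ℕ n ≡.≡ (n *ℕ n +ℕ m *ℕ n) +ℕ n
        e = solve-∀
      q^[n²+[2+m]n] : q ^ (n *ℕ n +ℕ suc (suc m) *ℕ n) ≈ E * (qⁿ * qⁿ)
      q^[n²+[2+m]n] =
        trans (^-congʳ q (e n m)) (trans (^-homo-* q k (n +ℕ n)) (*-congˡ (^-homo-* q n n)))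
        where
        e : ∀ n m → n *ℕ n +ℕ suc (suc m) *ℕ n ≡.≡ (n *ℕ n +ℕ m *ℕ n) +ℕ (n +ℕ n)
        e = solve-∀

    module _ {n j : ℕ} (m : ℕ) (j≤n : j ≤ℕ n) where
      private
        d : ℕ
        d = n ∸ℕ j
        P : ℕ → Carrier
        P i = 1# + q ^ i
        x y z A B G Π τ K : Carrier
        x = q ^ suc j
        y = q ^ d
        z = q ^ suc m
        A = gauss q n j
        B = gauss q n (suc j)
        G = gauss q (suc n) (suc j)
        Π = prodFrom (suc (d +ℕ suc m)) j P
        τ = t ((2 *ℕ n +ℕ suc m) ∸ℕ j)
        K = q ^ (j C 2) * Π * τ

        [1+n+m]∸j≡d+[1+m] : suc (n +ℕ m) ∸ℕ j ≡.≡ d +ℕ suc m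
        [1+n+m]∸j≡d+[1+m] = ≡.trans (≡.cong (_∸ℕ j) (≡.sym (ℕ.+-suc n m))) (ℕ.+-∸-comm (suc m) j≤n)

        [n+[2+m]]∸j≡1+d+[1+m] : (n +ℕ suc (suc m)) ∸ℕ j ≡.≡ suc (d +ℕ suc m)
        [n+[2+m]]∸j≡1+d+[1+m] = ≡.trans (ℕ.+-∸-comm (suc (suc m)) j≤n) (ℕ.+-suc d (suc m))

        q^[C[1+j]2]≈q^[C[j]2]*q^j : q ^ (suc j C 2) ≈ q ^ (j C 2) * q ^ j
        q^[C[1+j]2]≈q^[C[j]2]*q^j = trans (^-congʳ q ([1+n]C2≡nC2+n j)) (^-homo-* q (j C 2) j)

      summand-suc-n : summand (suc n) m (suc j) ≈ sgn (suc j) * (q ^ j * (G * (1# + y * z))) * K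
      summand-suc-n = begin
        sgn (suc j) * q ^ (suc j C 2) * G * prodFrom (suc (n +ℕ m) ∸ℕ j) (suc j) P
          * t ((2 *ℕ suc n +ℕ m) ∸ℕ suc j)
          ≈⟨ *-cong (*-cong (*-congʳ (*-congˡ q^[C[1+j]2]≈q^[C[j]2]*q^j)) first-factor)
                    (reflexive (≡.cong (t ∘ (_∸ℕ suc j)) (e n m))) ⟩
        sgn (suc j) * (q ^ (j C 2) * q ^ j) * G * ((1# + y * z) * Π) * τ
          ≈⟨ solve 7 (λ σ κ qʲ G W Π τ → σ :* (κ :* qʲ) :* G :* (W :* Π) :* τ
                                         := σ :* (qʲ :* (G :* W)) :* (κ :* Π :* τ))
                     refl (sgn (suc j)) (q ^ (j C 2)) (q ^ j) G (1# + y * z) Π τ ⟩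
        sgn (suc j) * (q ^ j * (G * (1# + y * z))) * K ∎
        where
        e : ∀ n m → 2 *ℕ suc n +ℕ m ≡.≡ suc (2 *ℕ n +ℕ suc m)
        e = solve-∀
        first-factor : prodFrom (suc (n +ℕ m) ∸ℕ j) (suc j) P ≈ (1# + y * z) * Π
        first-factor = trans (reflexive (≡.cong (λ a → prodFrom a (suc j) P) [1+n+m]∸j≡d+[1+m]))
                             (*-congʳ (+-congˡ (^-homo-* q d (suc m))))

      weighted-summand-suc-m : weight n m * summand n (suc m) j ≈ sgn j * (q ^ j * (y * (1# + z) * A)) * K
      weighted-summand-suc-m = begin
        q ^ n * (1# + z) * (sgn j * q ^ (j C 2) * A * prodFrom (suc (n +ℕ suc m) ∸ℕ j) j P * τ)
          ≈⟨ *-cong (*-congʳ qⁿ≈qʲ*y) (*-congʳ (*-congˡ (reflexive (≡.cong (λ a → prodFrom a j P) index)))) ⟩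
        q ^ j * y * (1# + z) * (sgn j * q ^ (j C 2) * A * Π * τ)
          ≈⟨ solve 8 (λ qʲ y z σ κ A Π τ → qʲ :* y :* (con 1 :+ z) :* (σ :* κ :* A :* Π :* τ)
                                           := σ :* (qʲ :* (y :* (con 1 :+ z) :* A)) :* (κ :* Π :* τ))
                     refl (q ^ j) y z (sgn j) (q ^ (j C 2)) A Π τ ⟩
        sgn j * (q ^ j * (y * (1# + z) * A)) * K ∎
        where
        qⁿ≈qʲ*y : q ^ n ≈ q ^ j * y
        qⁿ≈qʲ*y = trans (^-congʳ q (≡.sym (ℕ.m+[n∸m]≡n j≤n))) (^-homo-* q j d)
        index : suc (n +ℕ suc m) ∸ℕ j ≡.≡ suc (d +ℕ suc m)
        index = ≡.trans (≡.cong (_∸ℕ j) (≡.sym (ℕ.+-suc n (suc m)))) [n+[2+m]]∸j≡1+d+[1+m]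

      summand-suc-suc-m : summand n (suc (suc m)) (suc j)
                          ≈ sgn (suc j) * (q ^ j * (B * (1# + x * y * z))) * K
      summand-suc-suc-m = begin
        sgn (suc j) * q ^ (suc j C 2) * B * prodFrom ((n +ℕ suc (suc m)) ∸ℕ j) (suc j) P
          * t ((2 *ℕ n +ℕ suc (suc m)) ∸ℕ suc j)
          ≈⟨ *-cong (*-cong (*-congʳ (*-congˡ q^[C[1+j]2]≈q^[C[j]2]*q^j)) last-factor)
                    (reflexive (≡.cong (t ∘ (_∸ℕ suc j)) (ℕ.+-suc (2 *ℕ n) (suc m)))) ⟩
        sgn (suc j) * (q ^ (j C 2) * q ^ j) * B * (Π * (1# + x * y * z)) * τ
          ≈⟨ solve 7 (λ σ κ qʲ B W Π τ → σ :* (κ :* qʲ) :* B :* (Π :* W) :* τ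
                                         := σ :* (qʲ :* (B :* W)) :* (κ :* Π :* τ))
                     refl (sgn (suc j)) (q ^ (j C 2)) (q ^ j) B (1# + x * y * z) Π τ ⟩
        sgn (suc j) * (q ^ j * (B * (1# + x * y * z))) * K ∎
        where
        e : ∀ d m j → suc (d +ℕ suc m) +ℕ j ≡.≡ (suc j +ℕ d) +ℕ suc m
        e = solve-∀
        q^[top]≈x*y*z : q ^ (suc (d +ℕ suc m) +ℕ j) ≈ x * y * z
        q^[top]≈x*y*z = trans (^-congʳ q (e d m j))
                              (trans (^-homo-* q (suc j +ℕ d) (suc m)) (*-congʳ (^-homo-* q (suc j) d)))
        last-factor : prodFrom ((n +ℕ suc (suc m)) ∸ℕ j) (suc j) P ≈ Π * (1# + x * y * z)
        last-factor = trans (reflexive (≡.cong (λ a → prodFrom a (suc j) P) [n+[2+m]]∸j≡1+d+[1+m]))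
                            (trans (prodFrom-snoc (suc (d +ℕ suc m)) j P) (*-congˡ (+-congˡ q^[top]≈x*y*z)))

      summand-recurrence : summand (suc n) m (suc j) + weight n m * summand n (suc m) j
                           ≈ summand n (suc (suc m)) (suc j)
      summand-recurrence = begin
        summand (suc n) m (suc j) + weight n m * summand n (suc m) j
          ≈⟨ +-cong summand-suc-n weighted-summand-suc-m ⟩
        sgn (suc j) * (q ^ j * (G * (1# + y * z))) * K + sgn j * (q ^ j * (y * (1# + z) * A)) * K
          ≈⟨ alternating-cancel (sgn-suc+sgn j) X≈Y+Z ⟩
        sgn (suc j) * (q ^ j * (B * (1# + x * y * z))) * K
          ≈⟨ summand-suc-suc-m ⟨
        summand n (suc (suc m)) (suc j) ∎
        where
        X≈Y+Z : q ^ j * (G * (1# + y * z)) ≈ q ^ j * (y * (1# + z) * A) + q ^ j * (B * (1# + x * y * z))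
        X≈Y+Z = trans (*-congˡ (pascal-combination (gauss-pascalʳ q n j j≤n) refl))
                      (distribˡ (q ^ j) (y * (1# + z) * A) (B * (1# + x * y * z)))

    summand-at-0 : ∀ n m → summand (suc n) m 0 ≈ summand n (suc (suc m)) 0
    summand-at-0 n m = *-congˡ (reflexive (≡.cong t (e n m)))
      where
      e : ∀ n m → 2 *ℕ suc n +ℕ m ≡.≡ 2 *ℕ n +ℕ suc (suc m)
      e = solve-∀

    summand-beyond : ∀ n m → summand n m (suc n) ≈ 0#
    summand-beyond n m = trans (*-congʳ (*-congʳ (*-congˡ (gauss-vanishes q {n} ℕ.≤-refl))))
      (solve 4 (λ σ κ Π τ → σ :* κ :* con 0 :* Π :* τ := con 0) refl (sgn (suc n)) (q ^ (suc n C 2)) Π τ)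
      where
      Π τ : Carrier
      Π = prodFrom (suc (n +ℕ m) ∸ℕ suc n) (suc n) (λ i → 1# + q ^ i)
      τ = t ((2 *ℕ n +ℕ m) ∸ℕ suc n)

    sumTo-summand≈rhs : ∀ n m → sumTo n (summand n m) ≈ rhs n m
    sumTo-summand≈rhs zero    m = sym (trans (*-congʳ (*-congʳ (^-congʳ q (ℕ.*-zeroʳ m))))
      (solve 1 (λ τ → con 1 :* con 1 :* τ := con 1 :* con 1 :* con 1 :* con 1 :* τ) refl (t m)))
    sumTo-summand≈rhs (suc n) m = +-cancelʳ (w * rhs n (suc m)) _ _ (begin
      sumTo (suc n) (summand (suc n) m) + w * rhs n (suc m)
        ≈⟨ +-congˡ (*-congˡ (sumTo-summand≈rhs n (suc m))) ⟨
      sumTo (suc n) (summand (suc n) m) + w * sumTo n (summand n (suc m))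
        ≈⟨ sumTo-suc-combine n w (summand-at-0 n m) (λ j j≤n → summand-recurrence m j≤n) ⟩
      sumTo n (summand n (suc (suc m))) + summand n (suc (suc m)) (suc n)
        ≈⟨ +-congˡ (summand-beyond n (suc (suc m))) ⟩
      sumTo n (summand n (suc (suc m))) + 0#
        ≈⟨ +-identityʳ (sumTo n (summand n (suc (suc m)))) ⟩
      sumTo n (summand n (suc (suc m)))
        ≈⟨ sumTo-summand≈rhs n (suc (suc m)) ⟩
      rhs n (suc (suc m))
        ≈⟨ rhs-recurrence n m ⟨
      rhs (suc n) m + w * rhs n (suc m) ∎)
      where
      w : Carrier
      w = weight n m

theorem3p2 : (R : RealField) → let open Ops R in
    (q s : Carrier) → ¬ (q ≈ - 1#) → (n m : ℕ) →
      sumTo n (λ j → sgn j * q ^ (j C 2) * qbinom q n j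
                     * prodFrom (suc (n +ℕ m) ∸ℕ j) j (λ i → 1# + q ^ i)
                     * T 1# s q ((2 *ℕ n +ℕ m) ∸ℕ j))
        ≈ q ^ (n *ℕ n +ℕ m *ℕ n) * s ^ n * T 1# s q m
theorem3p2 R q s q≉-1 n m = begin
  sumTo n (λ j → sgn j * q ^ (j C 2) * qbinom q n j * Π j * τ j)
    ≈⟨ sumTo-cong R n (λ j j≤n → *-congʳ (*-congʳ (*-congˡ (qbinom≈gauss R q q≉-1 j≤n)))) ⟩
  sumTo n (summand R q s n m)
    ≈⟨ sumTo-summand≈rhs R q s n m ⟩
  q ^ (n *ℕ n +ℕ m *ℕ n) * s ^ n * T 1# s q m ∎
  where
  open Ops R
  open import Relation.Binary.Reasoning.Setoid setoid
  Π τ : ℕ → Carrier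
  Π j = prodFrom (suc (n +ℕ m) ∸ℕ j) j (λ i → 1# + q ^ i)
  τ j = T 1# s q ((2 *ℕ n +ℕ m) ∸ℕ j)
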